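{- Let $\Pi_q$ be a projective plane of order $q$, let $k\geq 1$, let $P$ be a point, and let $\ell_1,\ldots,\ell_s$ be $s$ distinct lines through $P$, where $2\leq s\leq q+1$. For $i\in\{1,2\}$ let $X_i\subseteq\ell_i\setminus\{P\}$ be a set of size $t_i$, $0\leq t_i\leq q$. Let $S=\bigcup_{i=3}^{s}(\ell_i\setminus\{P\})\cup X_1\cup X_2$. Then $|S|=(s-2)q+t_1+t_2$, and for every line $\ell$ of $\Pi_q$ we have $|S\cap\ell|\in\{0,t_1,t_2,s-2,s-1,s,q\}$.
   Context: A projective plane of order $q$ has $q^2+q+1$ points and $q^2+q+1$ lines, each line has $q+1$ points, each point lies on $q+1$ lines, two points lie on a unique line and two lines meet in a unique point. Lines are identified with their point sets. -}

module Defs where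

open import Data.Nat using (ℕ; suc; _+_; _*_)
open import Data.Fin using (Fin; zero; suc)
open import Data.Fin.Subset using (Subset; _∈_; ∣_∣; _∩_)
open import Data.Vec using (lookup; tabulate)
open import Data.Product using (_×_; ∃!)
open import Relation.Binary.PropositionalEquality using (_≡_; _≢_)
open import Function.Definitions using (Injective)

numPts : ℕ → ℕ
numPts q = q * q + q + 1

record ProjectivePlane (q : ℕ) : Set where
  field
    line : Fin (numPts q) → Subset (numPts q)
    -- lines are identified with their point sets (distinct indices, distinct sets)
    line-injective : Injective _≡_ _≡_ line
    line-size : ∀ j → ∣ line j ∣ ≡ suc q
    point-degree : ∀ p → ∣ tabulate (λ j → lookup (line j) p) ∣ ≡ suc q
    two-points : ∀ p p′ → p ≢ p′ →
      ∃! _≡_ (λ j → (p ∈ line j) × (p′ ∈ line j))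
    two-lines : ∀ j j′ → j ≢ j′ →
      ∃! _≡_ (λ p → (p ∈ line j) × (p ∈ line j′))

{-# OPTIONS --safe #-}

-- The sets X₁, X₂ and ℓᵢ ∖ {P} (i ≥ 3) lie on distinct lines through P and avoid P, so they are
-- pairwise disjoint and |S ∩ ℓ| is the sum of their traces on ℓ. If ℓ = ℓᵢ, only the i-th set
-- meets ℓ, and entirely; any other line through P misses all of them; a line not through P meets
-- each of them in at most one point, and each full set ℓᵢ ∖ {P} in exactly one, giving
-- s - 2 + (0, 1 or 2).

module Submission where

open import Defs
open import Data.Nat using (ℕ; suc; _+_; _*_; _≤_)
open import Data.Fin using (Fin; zero; suc)
open import Data.Fin.Subset using (Subset; _∈_; _∉_; _⊆_; ∣_∣; _∩_; _∪_; _─_; ⁅_⁆; ⋃)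
open import Data.List using (List; map; allFin; _∷_; [])
open import Data.List.Membership.Propositional using () renaming (_∈_ to _∈ᴸ_)
open import Data.Product using (_×_)
open import Relation.Binary.PropositionalEquality using (_≡_)
open import Function.Definitions using (Injective)

open import Data.Empty using (⊥-elim)
open import Data.Fin using (punchIn)
open import Data.Fin.Properties using (_≟_; any?; suc-injective; punchInᵢ≢i)
open import Data.Fin.Subset using (Empty; _-_; inside; outside)
open import Data.Fin.Subset.Properties
  using ( _∈?_; Empty-unique; drop-∷-Empty; ∣⊥∣≡0; ∉⊥; x∈⁅x⁆; x∈⁅y⁆⇒x≡y; ∣⁅x⁆∣≡1
        ; ⊆-antisym; p⊆q⇒∣p∣≤∣q∣; p∩q⊆p; x∈p∩q⁺; x∈p∩q⁻; x∈p∪q⁻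
        ; ∩-zeroˡ; ∩-distribʳ-∪; ∪-assoc; ∪-comm; p─⊥≡p; p─q⊆p; x∈p∧x≢y⇒x∈p-y )
open import Data.List using (tabulate)
open import Data.List.Properties using (map-tabulate)
open import Data.List.Relation.Unary.Any using (here; there)
open import Data.Nat using (z≤n; s≤s)
open import Data.Nat.Properties
  using (+-0-commutativeMonoid; +-suc; +-comm; +-assoc; +-identityʳ; *-zeroʳ; *-identityʳ)
  renaming (suc-injective to ℕ-suc-injective)
open import Algebra.Properties.CommutativeMonoid.Sum +-0-commutativeMonoid
  using (sum; sum-syntax; sum-remove)
open import Data.Product using (_,_; ∃)
open import Data.Sum using (inj₁; inj₂)
open import Data.Vec using ([]; _∷_; here; there)
open import Function using (_∘_; id)
open import Relation.Binary.PropositionalEquality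
  using (_≢_; refl; sym; trans; cong; cong₂; subst; module ≡-Reasoning)
open import Relation.Nullary using (yes; no)

open ≡-Reasoning

∑-const : ∀ m {f : Fin m → ℕ} {c : ℕ} → (∀ i → f i ≡ c) → ∑[ i < m ] f i ≡ m * c
∑-const 0       f≡c = refl
∑-const (suc m) f≡c = cong₂ _+_ (f≡c zero) (∑-const m (f≡c ∘ suc))

∑-single : ∀ {m} (f : Fin m → ℕ) (i : Fin m) → (∀ j → j ≢ i → f j ≡ 0) → ∑[ j < m ] f j ≡ f i
∑-single {suc m} f i others≡0 = begin
  sum f                                ≡⟨ sum-remove f ⟩
  f i + ∑[ j < m ] f (punchIn i j)     ≡⟨ cong (f i +_) (∑-const m (λ j → others≡0 _ (punchInᵢ≢i i j))) ⟩
  f i + m * 0                          ≡⟨ cong (f i +_) (*-zeroʳ m) ⟩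
  f i + 0                              ≡⟨ +-identityʳ (f i) ⟩
  f i                                  ∎

module _ {n : ℕ} where

  Empty⇒∣p∣≡0 : {p : Subset n} → Empty p → ∣ p ∣ ≡ 0
  Empty⇒∣p∣≡0 p-empty = trans (cong ∣_∣ (Empty-unique p-empty)) (∣⊥∣≡0 n)

  p⊆q⇒p∩q≡p : {p q : Subset n} → p ⊆ q → p ∩ q ≡ p
  p⊆q⇒p∩q≡p {p} {q} p⊆q = ⊆-antisym (p∩q⊆p p q) (λ x∈p → x∈p∩q⁺ (x∈p , p⊆q x∈p))

  x∉q⇒p-x∩q≡p∩q : {x : Fin n} (p q : Subset n) → x ∉ q → (p - x) ∩ q ≡ p ∩ q
  x∉q⇒p-x∩q≡p∩q p q x∉q = ⊆-antisym
    (λ y∈ → let y∈p-x , y∈q = x∈p∩q⁻ (p - _) q y∈ in x∈p∩q⁺ (p─q⊆p p _ y∈p-x , y∈q))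
    (λ y∈ → let y∈p , y∈q = x∈p∩q⁻ p q y∈ in
      x∈p∩q⁺ (x∈p∧x≢y⇒x∈p-y y∈p (λ { refl → x∉q y∈q }) , y∈q))

x∈p-y⇒x≢y : ∀ {n} {x y : Fin n} {p : Subset n} → x ∈ p - y → x ≢ y
x∈p-y⇒x≢y {x = zero}  {p = _ ∷ _} ()             refl
x∈p-y⇒x≢y {x = suc x} {p = _ ∷ p} (there x∈p-y) refl = x∈p-y⇒x≢y {p = p} x∈p-y refl

∣p∪q∣≡∣p∣+∣q∣ : ∀ {n} (p q : Subset n) → Empty (p ∩ q) → ∣ p ∪ q ∣ ≡ ∣ p ∣ + ∣ q ∣
∣p∪q∣≡∣p∣+∣q∣ []            []            _        = refl
∣p∪q∣≡∣p∣+∣q∣ (inside  ∷ p) (inside  ∷ q) p∩q-empty = ⊥-elim (p∩q-empty (zero , here))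
∣p∪q∣≡∣p∣+∣q∣ (inside  ∷ p) (outside ∷ q) p∩q-empty =
  cong suc (∣p∪q∣≡∣p∣+∣q∣ p q (drop-∷-Empty p∩q-empty))
∣p∪q∣≡∣p∣+∣q∣ (outside ∷ p) (inside  ∷ q) p∩q-empty =
  trans (cong suc (∣p∪q∣≡∣p∣+∣q∣ p q (drop-∷-Empty p∩q-empty))) (sym (+-suc ∣ p ∣ ∣ q ∣))
∣p∪q∣≡∣p∣+∣q∣ (outside ∷ p) (outside ∷ q) p∩q-empty =
  ∣p∪q∣≡∣p∣+∣q∣ p q (drop-∷-Empty p∩q-empty)

x∈p⇒suc∣p-x∣≡∣p∣ : ∀ {n} {x : Fin n} {p : Subset n} → x ∈ p → suc ∣ p - x ∣ ≡ ∣ p ∣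
x∈p⇒suc∣p-x∣≡∣p∣ {x = zero}  {inside  ∷ p} here         = cong (suc ∘ ∣_∣) (p─⊥≡p p)
x∈p⇒suc∣p-x∣≡∣p∣ {x = suc x} {inside  ∷ p} (there x∈p) = cong suc (x∈p⇒suc∣p-x∣≡∣p∣ x∈p)
x∈p⇒suc∣p-x∣≡∣p∣ {x = suc x} {outside ∷ p} (there x∈p) = x∈p⇒suc∣p-x∣≡∣p∣ x∈p

module _ {n : ℕ} where

  x∈⋃-tabulate⁻ : ∀ {m} (A : Fin m → Subset n) {x} → x ∈ ⋃ (tabulate A) → ∃ λ i → x ∈ A i
  x∈⋃-tabulate⁻ {0}     A x∈⊥ = ⊥-elim (∉⊥ x∈⊥)
  x∈⋃-tabulate⁻ {suc m} A x∈⋃ with x∈p∪q⁻ (A zero) _ x∈⋃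
  ... | inj₁ x∈A₀ = zero , x∈A₀
  ... | inj₂ x∈⋃′ = let i , x∈Aᵢ = x∈⋃-tabulate⁻ (A ∘ suc) x∈⋃′ in suc i , x∈Aᵢ

  ⋃-tabulate-∩ : ∀ {m} (A : Fin m → Subset n) (p : Subset n) →
                 ⋃ (tabulate A) ∩ p ≡ ⋃ (tabulate (λ i → A i ∩ p))
  ⋃-tabulate-∩ {0}     A p = ∩-zeroˡ p
  ⋃-tabulate-∩ {suc m} A p = begin
    (A zero ∪ ⋃ (tabulate (A ∘ suc))) ∩ p         ≡⟨ ∩-distribʳ-∪ p (A zero) _ ⟩
    A zero ∩ p ∪ ⋃ (tabulate (A ∘ suc)) ∩ p       ≡⟨ cong (A zero ∩ p ∪_) (⋃-tabulate-∩ (A ∘ suc) p) ⟩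
    A zero ∩ p ∪ ⋃ (tabulate (λ i → A (suc i) ∩ p)) ∎

  ∣⋃∣≡∑∣∣ : ∀ {m} (A : Fin m → Subset n) → (∀ {i j} → i ≢ j → Empty (A i ∩ A j)) →
            ∣ ⋃ (tabulate A) ∣ ≡ ∑[ i < m ] ∣ A i ∣
  ∣⋃∣≡∑∣∣ {0}     A _        = ∣⊥∣≡0 n
  ∣⋃∣≡∑∣∣ {suc m} A disjoint = begin
    ∣ A zero ∪ ⋃ (tabulate (A ∘ suc)) ∣    ≡⟨ ∣p∪q∣≡∣p∣+∣q∣ (A zero) _ head-disjoint ⟩
    ∣ A zero ∣ + ∣ ⋃ (tabulate (A ∘ suc)) ∣
      ≡⟨ cong (∣ A zero ∣ +_) (∣⋃∣≡∑∣∣ (A ∘ suc) (disjoint ∘ (_∘ suc-injective))) ⟩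
    ∣ A zero ∣ + ∑[ i < m ] ∣ A (suc i) ∣   ∎
    where
    head-disjoint : Empty (A zero ∩ ⋃ (tabulate (A ∘ suc)))
    head-disjoint (x , x∈) =
      let x∈A₀ , x∈⋃ = x∈p∩q⁻ (A zero) _ x∈
          i , x∈Aᵢ   = x∈⋃-tabulate⁻ (A ∘ suc) x∈⋃
      in disjoint (λ ()) (x , x∈p∩q⁺ (x∈A₀ , x∈Aᵢ))

module _ {q : ℕ} (Π : ProjectivePlane q) where

  open ProjectivePlane Π

  ∣line-x∣≡q : ∀ {j x} → x ∈ line j → ∣ line j - x ∣ ≡ q
  ∣line-x∣≡q {j} x∈j = ℕ-suc-injective (trans (x∈p⇒suc∣p-x∣≡∣p∣ x∈j) (line-size j))

  ∣line∩line∣≡1 : ∀ {j j′} → j ≢ j′ → ∣ line j ∩ line j′ ∣ ≡ 1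
  ∣line∩line∣≡1 {j} {j′} j≢j′ with two-lines j j′ j≢j′
  ... | p , (p∈j , p∈j′) , unique = trans (cong ∣_∣ (⊆-antisym ⊆⁅p⁆ ⁅p⁆⊆)) (∣⁅x⁆∣≡1 p)
    where
    ⊆⁅p⁆ : line j ∩ line j′ ⊆ ⁅ p ⁆
    ⊆⁅p⁆ x∈ = subst (_∈ ⁅ p ⁆) (unique (x∈p∩q⁻ (line j) (line j′) x∈)) (x∈⁅x⁆ p)
    ⁅p⁆⊆ : ⁅ p ⁆ ⊆ line j ∩ line j′
    ⁅p⁆⊆ x∈⁅p⁆ with refl ← x∈⁅y⁆⇒x≡y p x∈⁅p⁆ = x∈p∩q⁺ (p∈j , p∈j′)

  ∣p∩line∣≤1 : ∀ {p j j′} → p ⊆ line j′ → j′ ≢ j → ∣ p ∩ line j ∣ ≤ 1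
  ∣p∩line∣≤1 {p} {j} {j′} p⊆j′ j′≢j =
    subst (∣ p ∩ line j ∣ ≤_) (∣line∩line∣≡1 j′≢j) (p⊆q⇒∣p∣≤∣q∣ p∩j⊆j′∩j)
    where
    p∩j⊆j′∩j : p ∩ line j ⊆ line j′ ∩ line j
    p∩j⊆j′∩j x∈ = let x∈p , x∈j = x∈p∩q⁻ p (line j) x∈ in x∈p∩q⁺ (p⊆j′ x∈p , x∈j)

  ∣line-x∩line∣≡1 : ∀ {x j j′} → x ∈ line j′ → x ∉ line j → ∣ (line j′ - x) ∩ line j ∣ ≡ 1
  ∣line-x∩line∣≡1 {x} {j} {j′} x∈j′ x∉j = begin
    ∣ (line j′ - x) ∩ line j ∣ ≡⟨ cong ∣_∣ (x∉q⇒p-x∩q≡p∩q (line j′) (line j) x∉j) ⟩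
    ∣ line j′ ∩ line j ∣       ≡⟨ ∣line∩line∣≡1 (λ { refl → x∉j x∈j′ }) ⟩
    1                          ∎

  ∈line-x⇒∉concurrent-line : ∀ {x y j j′} → y ∈ line j → y ∈ line j′ → j ≢ j′ →
                              x ∈ line j - y → x ∉ line j′
  ∈line-x⇒∉concurrent-line {j = j} {j′} y∈j y∈j′ j≢j′ x∈j-y x∈j′
    with two-lines j j′ j≢j′
  ... | p , _ , unique =
    x∈p-y⇒x≢y x∈j-y (trans (sym (unique (p─q⊆p _ _ x∈j-y , x∈j′))) (unique (y∈j , y∈j′)))

  module Pencil {m : ℕ} (P : Fin (numPts q)) (ℓ : Fin m → Fin (numPts q))
                (ℓ-injective : Injective _≡_ _≡_ ℓ) (P∈ℓ : ∀ i → P ∈ line (ℓ i)) where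

    OnPencil : (Fin m → Subset (numPts q)) → Set
    OnPencil A = ∀ i → A i ⊆ line (ℓ i) - P

    Empty-p∩line : ∀ {p i j} → p ⊆ line (ℓ i) - P → P ∈ line j → ℓ i ≢ j → Empty (p ∩ line j)
    Empty-p∩line {p} {i} {j} p⊆ℓi-P P∈j ℓi≢j (x , x∈) =
      let x∈p , x∈j = x∈p∩q⁻ p (line j) x∈
      in ∈line-x⇒∉concurrent-line (P∈ℓ i) P∈j ℓi≢j (p⊆ℓi-P x∈p) x∈j

    OnPencil⇒disjoint : ∀ {A} → OnPencil A → ∀ {i i′} → i ≢ i′ → Empty (A i ∩ A i′)
    OnPencil⇒disjoint {A} A-on {i} {i′} i≢i′ (x , x∈) =
      let x∈Aᵢ , x∈Aᵢ′ = x∈p∩q⁻ (A i) (A i′) x∈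
      in Empty-p∩line (A-on i) (P∈ℓ i′) (i≢i′ ∘ ℓ-injective)
           (x , x∈p∩q⁺ (x∈Aᵢ , p─q⊆p _ _ (A-on i′ x∈Aᵢ′)))

    ∣⋃A∣≡∑∣A∣ : ∀ {A} → OnPencil A → ∣ ⋃ (tabulate A) ∣ ≡ ∑[ i < m ] ∣ A i ∣
    ∣⋃A∣≡∑∣A∣ {A} A-on = ∣⋃∣≡∑∣∣ A (OnPencil⇒disjoint A-on)

    ∣⋃A∩line∣≡∑∣A∩line∣ : ∀ {A} → OnPencil A → ∀ j →
                           ∣ ⋃ (tabulate A) ∩ line j ∣ ≡ ∑[ i < m ] ∣ A i ∩ line j ∣
    ∣⋃A∩line∣≡∑∣A∩line∣ {A} A-on j = trans (cong ∣_∣ (⋃-tabulate-∩ A (line j)))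
      (∣⋃A∣≡∑∣A∣ (λ i → A-on i ∘ p∩q⊆p (A i) (line j)))

    ∣⋃A∩ℓ∣≡∣A∣ : ∀ {A} → OnPencil A → ∀ i → ∣ ⋃ (tabulate A) ∩ line (ℓ i) ∣ ≡ ∣ A i ∣
    ∣⋃A∩ℓ∣≡∣A∣ {A} A-on i = begin
      ∣ ⋃ (tabulate A) ∩ line (ℓ i) ∣  ≡⟨ ∣⋃A∩line∣≡∑∣A∩line∣ A-on (ℓ i) ⟩
      ∑[ k < m ] ∣ A k ∩ line (ℓ i) ∣  ≡⟨ ∑-single _ i others-empty ⟩
      ∣ A i ∩ line (ℓ i) ∣             ≡⟨ cong ∣_∣ (p⊆q⇒p∩q≡p (p─q⊆p _ _ ∘ A-on i)) ⟩
      ∣ A i ∣                          ∎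
      where
      others-empty : ∀ k → k ≢ i → ∣ A k ∩ line (ℓ i) ∣ ≡ 0
      others-empty k k≢i = Empty⇒∣p∣≡0 (Empty-p∩line (A-on k) (P∈ℓ i) (k≢i ∘ ℓ-injective))

    ∣⋃A∩line∣≡0 : ∀ {A} → OnPencil A → ∀ {j} → P ∈ line j → (∀ i → ℓ i ≢ j) →
                  ∣ ⋃ (tabulate A) ∩ line j ∣ ≡ 0
    ∣⋃A∩line∣≡0 {A} A-on {j} P∈j j∉ℓ = begin
      ∣ ⋃ (tabulate A) ∩ line j ∣  ≡⟨ ∣⋃A∩line∣≡∑∣A∩line∣ A-on j ⟩
      ∑[ i < m ] ∣ A i ∩ line j ∣  ≡⟨ ∑-const m (λ i → Empty⇒∣p∣≡0 (Empty-p∩line (A-on i) P∈j (j∉ℓ i))) ⟩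
      m * 0                        ≡⟨ *-zeroʳ m ⟩
      0                            ∎

module Configuration {q : ℕ} (Π : ProjectivePlane q) (P : Fin (numPts q)) (r : ℕ)
  (ℓ : Fin (2 + r) → Fin (numPts q)) (ℓ-injective : Injective _≡_ _≡_ ℓ)
  (P∈ℓ : ∀ i → P ∈ ProjectivePlane.line Π (ℓ i)) (X₁ X₂ : Subset (numPts q))
  (X₁⊆ℓ₁ : X₁ ⊆ ProjectivePlane.line Π (ℓ zero)) (P∉X₁ : P ∉ X₁)
  (X₂⊆ℓ₂ : X₂ ⊆ ProjectivePlane.line Π (ℓ (suc zero))) (P∉X₂ : P ∉ X₂) where

  open ProjectivePlane Π
  open Pencil Π P ℓ ℓ-injective P∈ℓ

  S : Subset (numPts q)
  S = (⋃ (map (λ i → line (ℓ (suc (suc i))) ─ ⁅ P ⁆) (allFin r)) ∪ X₁) ∪ X₂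

  values : List ℕ
  values = 0 ∷ ∣ X₁ ∣ ∷ ∣ X₂ ∣ ∷ r ∷ 1 + r ∷ 2 + r ∷ q ∷ []

  piece : Fin (2 + r) → Subset (numPts q)
  piece zero          = X₁
  piece (suc zero)    = X₂
  piece (suc (suc i)) = line (ℓ (suc (suc i))) - P

  piece-on-pencil : OnPencil piece
  piece-on-pencil zero          x∈X₁ = x∈p∧x≢y⇒x∈p-y (X₁⊆ℓ₁ x∈X₁) (λ { refl → P∉X₁ x∈X₁ })
  piece-on-pencil (suc zero)    x∈X₂ = x∈p∧x≢y⇒x∈p-y (X₂⊆ℓ₂ x∈X₂) (λ { refl → P∉X₂ x∈X₂ })
  piece-on-pencil (suc (suc i)) x∈   = x∈

  S≡⋃piece : S ≡ ⋃ (tabulate piece)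
  S≡⋃piece = begin
    (⋃ (map full (allFin r)) ∪ X₁) ∪ X₂ ≡⟨ cong (λ F → (⋃ F ∪ X₁) ∪ X₂) (map-tabulate id full) ⟩
    (F ∪ X₁) ∪ X₂                       ≡⟨ ∪-assoc F X₁ X₂ ⟩
    F ∪ (X₁ ∪ X₂)                       ≡⟨ ∪-comm F (X₁ ∪ X₂) ⟩
    (X₁ ∪ X₂) ∪ F                       ≡⟨ ∪-assoc X₁ X₂ F ⟩
    X₁ ∪ (X₂ ∪ F)                       ∎
    where
    full : Fin r → Subset (numPts q)
    full i = line (ℓ (suc (suc i))) - P
    F : Subset (numPts q)
    F = ⋃ (tabulate full)

  ∣S∣≡rq+t₁+t₂ : ∣ S ∣ ≡ r * q + ∣ X₁ ∣ + ∣ X₂ ∣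
  ∣S∣≡rq+t₁+t₂ = begin
    ∣ S ∣                                                  ≡⟨ cong ∣_∣ S≡⋃piece ⟩
    ∣ ⋃ (tabulate piece) ∣                                 ≡⟨ ∣⋃A∣≡∑∣A∣ piece-on-pencil ⟩
    t₁ + (t₂ + ∑[ i < r ] ∣ line (ℓ (suc (suc i))) - P ∣)
      ≡⟨ cong (λ z → t₁ + (t₂ + z)) (∑-const r (λ i → ∣line-x∣≡q Π (P∈ℓ _))) ⟩
    t₁ + (t₂ + r * q)                                      ≡⟨ sym (+-assoc t₁ t₂ (r * q)) ⟩
    t₁ + t₂ + r * q                                        ≡⟨ +-comm (t₁ + t₂) (r * q) ⟩
    r * q + (t₁ + t₂)                                      ≡⟨ sym (+-assoc (r * q) t₁ t₂) ⟩
    r * q + t₁ + t₂                                        ∎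
    where
    t₁ = ∣ X₁ ∣
    t₂ = ∣ X₂ ∣

  ∣piece∣∈values : ∀ i → ∣ piece i ∣ ∈ᴸ values
  ∣piece∣∈values zero          = there (here refl)
  ∣piece∣∈values (suc zero)    = there (there (here refl))
  ∣piece∣∈values (suc (suc i)) = there (there (there (there (there (there (here (∣line-x∣≡q Π (P∈ℓ _))))))))

  a+[b+r]∈values : ∀ {a b} → a ≤ 1 → b ≤ 1 → a + (b + r) ∈ᴸ values
  a+[b+r]∈values z≤n       z≤n       = there (there (there (here refl)))
  a+[b+r]∈values z≤n       (s≤s z≤n) = there (there (there (there (here refl))))
  a+[b+r]∈values (s≤s z≤n) z≤n       = there (there (there (there (here refl))))
  a+[b+r]∈values (s≤s z≤n) (s≤s z≤n) = there (there (there (there (there (here refl)))))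

  ∣⋃piece∩line∣∈values : ∀ j → P ∉ line j → ∣ ⋃ (tabulate piece) ∩ line j ∣ ∈ᴸ values
  ∣⋃piece∩line∣∈values j P∉j =
    subst (_∈ᴸ values) (sym ∣⋃piece∩j∣≡) (a+[b+r]∈values (at-most-one zero) (at-most-one (suc zero)))
    where
    ℓ≢j : ∀ i → ℓ i ≢ j
    ℓ≢j i refl = P∉j (P∈ℓ i)
    at-most-one : ∀ i → ∣ piece i ∩ line j ∣ ≤ 1
    at-most-one i = ∣p∩line∣≤1 Π (p─q⊆p _ _ ∘ piece-on-pencil i) (ℓ≢j i)
    ∣⋃piece∩j∣≡ : ∣ ⋃ (tabulate piece) ∩ line j ∣ ≡ ∣ X₁ ∩ line j ∣ + (∣ X₂ ∩ line j ∣ + r)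
    ∣⋃piece∩j∣≡ = begin
      ∣ ⋃ (tabulate piece) ∩ line j ∣ ≡⟨ ∣⋃A∩line∣≡∑∣A∩line∣ piece-on-pencil j ⟩
      ∣ X₁ ∩ line j ∣ + (∣ X₂ ∩ line j ∣ + ∑[ i < r ] ∣ (line (ℓ (suc (suc i))) - P) ∩ line j ∣)
        ≡⟨ cong (λ z → ∣ X₁ ∩ line j ∣ + (∣ X₂ ∩ line j ∣ + z))
                (∑-const r (λ i → ∣line-x∩line∣≡1 Π (P∈ℓ _) P∉j)) ⟩
      ∣ X₁ ∩ line j ∣ + (∣ X₂ ∩ line j ∣ + r * 1)
        ≡⟨ cong (λ z → ∣ X₁ ∩ line j ∣ + (∣ X₂ ∩ line j ∣ + z)) (*-identityʳ r) ⟩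
      ∣ X₁ ∩ line j ∣ + (∣ X₂ ∩ line j ∣ + r) ∎

  ∣S∩line∣∈values : ∀ j → ∣ S ∩ line j ∣ ∈ᴸ values
  ∣S∩line∣∈values j rewrite S≡⋃piece with P ∈? line j | any? (λ i → ℓ i ≟ j)
  ... | no P∉j | _              = ∣⋃piece∩line∣∈values j P∉j
  ... | yes P∈j | yes (i , refl) = subst (_∈ᴸ values) (sym (∣⋃A∩ℓ∣≡∣A∣ piece-on-pencil i)) (∣piece∣∈values i)
  ... | yes P∈j | no j∉ℓ         = here (∣⋃A∩line∣≡0 piece-on-pencil P∈j (λ i ℓi≡j → j∉ℓ (i , ℓi≡j)))

mainTheorem6 : (q : ℕ) (Π : ProjectivePlane q) (k : ℕ) → 1 ≤ k →
    (P : Fin (numPts q)) (r : ℕ) → 2 + r ≤ q + 1 →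
    (ℓ : Fin (2 + r) → Fin (numPts q)) → Injective _≡_ _≡_ ℓ →
    (∀ i → P ∈ ProjectivePlane.line Π (ℓ i)) →
    (X₁ X₂ : Subset (numPts q)) →
    X₁ ⊆ ProjectivePlane.line Π (ℓ zero) → P ∉ X₁ →
    X₂ ⊆ ProjectivePlane.line Π (ℓ (suc zero)) → P ∉ X₂ →
    let t₁ = ∣ X₁ ∣
        t₂ = ∣ X₂ ∣
        S = (⋃ (map (λ i → ProjectivePlane.line Π (ℓ (suc (suc i))) ─ ⁅ P ⁆) (allFin r)) ∪ X₁) ∪ X₂
    in (∣ S ∣ ≡ r * q + t₁ + t₂)
       × (∀ j → ∣ S ∩ ProjectivePlane.line Π j ∣ ∈ᴸ (0 ∷ t₁ ∷ t₂ ∷ r ∷ 1 + r ∷ 2 + r ∷ q ∷ []))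
mainTheorem6 q Π _ _ P r _ ℓ ℓ-injective P∈ℓ X₁ X₂ X₁⊆ℓ₁ P∉X₁ X₂⊆ℓ₂ P∉X₂ =
  ∣S∣≡rq+t₁+t₂ , ∣S∩line∣∈values
  where open Configuration Π P r ℓ ℓ-injective P∈ℓ X₁ X₂ X₁⊆ℓ₁ P∉X₁ X₂⊆ℓ₂ P∉X₂
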